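{- Let $M$ be a uniform matroid on a ground set $E=\{e_1,\ldots,e_n\}$ and, for $i\in\{0,\ldots,n\}$, let $E_i=\{e_1,\ldots,e_i\}$. Then the number of minors of $M$ on $E\setminus E_i$ is $\lambda_M(E_i)+1$.
   Context: A matroid $M$ is uniform if its independent sets are exactly the subsets of $E$ of size at most $r(M)$. $r_M(X)=\max\{|I|: I\subseteq X, I \text{ independent}\}$ is the rank function, $r(M)=r_M(E)$, and the connectivity function is $\lambda_M(X)=r_M(X)+r_M(E\setminus X)-r(M)$. For disjoint $X,Y\subseteq E$, $M\setminus X/Y$ denotes the matroid obtained by deleting $X$ and contracting $Y$. The minors of $M$ on $E\setminus E_i$ are the matroids $M\setminus(E_i\setminus Y)/Y$ for $Y\subseteq E_i$; their number means the number of distinct such matroids (distinct collections of independent sets). -}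

module Defs where

open import Data.Bool using (Bool; true; false)
open import Data.Nat using (ℕ; zero; suc; _+_; _∸_; _≤_; _<_; _⊔_; _<ᵇ_)
open import Data.Fin using (Fin; toℕ)
open import Data.Fin.Subset using (Subset; _∈_; _∉_; _⊆_; _∪_; ⁅_⁆; ∣_∣; ⊥; ⊤; ∁; inside; outside)
open import Data.Fin.Subset.Properties using (_⊆?_)
open import Data.Vec using (Vec; []; _∷_; tabulate)
import Data.Vec.Properties as VecP
import Data.Bool.Properties as BoolP
import Data.List.Properties as ListP
open import Data.List using (List; []; _∷_; [_]; map; _++_; filter; foldr; length; deduplicate)
open import Data.Product using (_×_; ∃-syntax)
open import Relation.Binary.PropositionalEquality using (_≡_)
open import Relation.Nullary.Decidable using (_×-dec_)

-- A matroid on the ground set E = Fin n (elements e₁,…,eₙ are 0,…,n-1),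
-- given by a (decidable, Bool-valued) independence predicate satisfying
-- the independence axioms.
record Matroid (n : ℕ) : Set where
  field
    indep       : Subset n → Bool
    indep-empty : indep ⊥ ≡ true
    indep-hered : ∀ {I J} → J ⊆ I → indep I ≡ true → indep J ≡ true
    indep-aug   : ∀ {I J} → indep I ≡ true → indep J ≡ true → ∣ I ∣ < ∣ J ∣ →
                  ∃[ e ] (e ∈ J × e ∉ I × indep (I ∪ ⁅ e ⁆) ≡ true)
open Matroid public

allSubsets : (n : ℕ) → List (Subset n)
allSubsets zero = [ [] ]
allSubsets (suc n) = map (outside ∷_) (allSubsets n) ++ map (inside ∷_) (allSubsets n)

maxList : List ℕ → ℕ
maxList = foldr _⊔_ 0

rk : ∀ {n} → Matroid n → Subset n → ℕ
rk {n} M X = maxList (map ∣_∣ (filter (λ Y → (Y ⊆? X) ×-dec (indep M Y Data.Bool.≟ true)) (allSubsets n)))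
  where import Data.Bool

rank : ∀ {n} → Matroid n → ℕ
rank M = rk M ⊤

-- connectivity function λ_M(X) = r(X) + r(E ∖ X) - r(M)
-- (truncated subtraction; the true value is always ≥ 0 by submodularity)
conn : ∀ {n} → Matroid n → Subset n → ℕ
conn M X = rk M X + rk M (∁ X) ∸ rank M

IsUniform : ∀ {n} → Matroid n → Set
IsUniform {n} M = ∀ (X : Subset n) → (indep M X ≡ true → ∣ X ∣ ≤ rank M) × (∣ X ∣ ≤ rank M → indep M X ≡ true)

initSeg : (n i : ℕ) → Subset n
initSeg n i = tabulate (λ k → toℕ k <ᵇ i)

-- The minor M \ (E_i ∖ Y) / Y, a matroid on E ∖ E_i, represented by the list
-- of its independent sets (listed in the fixed order of allSubsets).
minorIndeps : ∀ {n} → Matroid n → (i : ℕ) → Subset n → List (Subset n)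
minorIndeps {n} M i Y =
  filter (λ I → (I ⊆? ∁ (initSeg n i)) ×-dec (rk M (I ∪ Y) Data.Nat.≟ ∣ I ∣ + rk M Y)) (allSubsets n)
  where import Data.Nat

minorsOn : ∀ {n} → Matroid n → (i : ℕ) → List (List (Subset n))
minorsOn {n} M i = map (minorIndeps M i) (filter (λ Y → Y ⊆? initSeg n i) (allSubsets n))

numMinors : ∀ {n} → Matroid n → (i : ℕ) → ℕ
numMinors M i = length (deduplicate (ListP.≡-dec (VecP.≡-dec BoolP._≟_)) (minorsOn M i))

{-# OPTIONS --safe #-}
module Submission where

-- In a uniform matroid of rank r every set X has rank ∣X∣ ⊓ r. So for Y ⊆ E_i the
-- minor M \ (E_i − Y) / Y is the uniform matroid on C = E − E_i whose independent sets
-- are those of size at most r − ∣Y∣; it depends only on the level (r − ∣Y∣) ⊓ ∣C∣, and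
-- distinct levels give distinct minors. As ∣Y∣ runs through 0, …, ∣E_i∣ the level drops
-- by at most one per step, so it takes exactly the values from (r − ∣E_i∣) ⊓ ∣C∣ up to
-- r ⊓ ∣C∣. Since r ≤ ∣E_i∣ + ∣C∣, there are r ⊓ ∣C∣ − (r − ∣E_i∣) + 1 = λ(E_i) + 1 of them.

open import Defs
open import Data.Bool using (true)
import Data.Bool.Properties as BoolP
open import Data.Nat using (ℕ; zero; suc; _+_; _∸_; _⊓_; _≤_; _<_; z≤n; s≤s; s≤s⁻¹; _≤?_)
import Data.Nat as ℕ
open import Data.Nat.Properties
open import Data.Fin.Subset using (Subset; inside; outside; ∁; _∪_; _⊆_; ∣_∣; ⊤)
open import Data.Fin.Subset.Properties
  using (_⊆?_; drop-∷-⊆; out⊆; in⊆in; ⊆-min; ∣⊥∣≡0; ∣⊤∣≡n; ∣p∣≤n; ∣∁p∣≡n∸∣p∣;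
         p⊆q⇒∣p∣≤∣q∣; x∈∁p⇒x∉p; x∉p⇒x∈∁p)
open import Data.Vec using ([]; _∷_; here)
import Data.Vec.Properties as VecP
open import Data.List using (List; []; _∷_; map; filter; length; applyUpTo; deduplicate)
import Data.List.Properties as ListP
open import Data.List.Properties using (filter-≐; length-applyUpTo)
open import Data.List.Membership.Propositional using (_∈_)
open import Data.List.Membership.Propositional.Properties
  using (∈-++⁺ˡ; ∈-++⁺ʳ; ∈-map⁺; ∈-map⁻; ∈-filter⁺; ∈-filter⁻;
         ∈-applyUpTo⁺; ∈-applyUpTo⁻; deduplicate-∈⇔)
open import Data.List.Membership.Propositional.Properties.WithK using (unique∧set⇒bag)
open import Data.List.Relation.Unary.Any using (here; there)
open import Data.List.Relation.Unary.All as All using (All)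
open import Data.List.Relation.Unary.Unique.Propositional using (Unique)
open import Data.List.Relation.Unary.Unique.Propositional.Properties using (applyUpTo⁺₁)
open import Data.List.Relation.Unary.Unique.DecPropositional.Properties using (deduplicate-!)
open import Data.List.Relation.Binary.BagAndSetEquality using (∼bag⇒↭)
open import Data.List.Relation.Binary.Permutation.Propositional.Properties using (↭-length)
open import Data.Product using (_×_; _,_; proj₁; proj₂; ∃-syntax)
open import Data.Sum using (inj₁; inj₂)
open import Function using (_∘_)
open import Function.Bundles using (_⇔_; mk⇔; Equivalence)
open import Function.Construct.Composition using (_⇔-∘_)
open import Function.Construct.Symmetry using (⇔-sym)
open import Relation.Binary.Definitions using (DecidableEquality)
open import Relation.Binary.PropositionalEquality
  using (_≡_; refl; sym; trans; cong; cong₂; subst; module ≡-Reasoning)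
open import Relation.Nullary using (yes; no; contradiction)
open import Relation.Nullary.Decidable using (_×-dec_)
open import Relation.Unary using (Decidable)

∈-allSubsets : ∀ {n} (p : Subset n) → p ∈ allSubsets n
∈-allSubsets [] = here refl
∈-allSubsets {suc n} (outside ∷ p) = ∈-++⁺ˡ (∈-map⁺ (outside ∷_) (∈-allSubsets p))
∈-allSubsets {suc n} (inside ∷ p) =
  ∈-++⁺ʳ (map (outside ∷_) (allSubsets n)) (∈-map⁺ (inside ∷_) (∈-allSubsets p))

⊆-ofSize : ∀ {n} (p : Subset n) {k} → k ≤ ∣ p ∣ → ∃[ q ] (q ⊆ p × ∣ q ∣ ≡ k)
⊆-ofSize {n} p {zero} _ = _ , ⊆-min p , ∣⊥∣≡0 n
⊆-ofSize (outside ∷ p) {suc k} k<∣p∣ with q , q⊆p , ∣q∣≡k ← ⊆-ofSize p k<∣p∣ =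
  outside ∷ q , out⊆ q⊆p , ∣q∣≡k
⊆-ofSize (inside ∷ p) {suc k} k<∣p∣ with q , q⊆p , ∣q∣≡k ← ⊆-ofSize p (s≤s⁻¹ k<∣p∣) =
  inside ∷ q , in⊆in q⊆p , cong suc ∣q∣≡k

∣p∪q∣≡∣p∣+∣q∣ : ∀ {n} {p q : Subset n} → p ⊆ ∁ q → ∣ p ∪ q ∣ ≡ ∣ p ∣ + ∣ q ∣
∣p∪q∣≡∣p∣+∣q∣ {p = []} {[]} _ = refl
∣p∪q∣≡∣p∣+∣q∣ {p = inside ∷ p} {inside ∷ q} p⊆∁q = contradiction (p⊆∁q here) λ ()
∣p∪q∣≡∣p∣+∣q∣ {p = inside ∷ p} {outside ∷ q} p⊆∁q = cong suc (∣p∪q∣≡∣p∣+∣q∣ (drop-∷-⊆ p⊆∁q))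
∣p∪q∣≡∣p∣+∣q∣ {p = outside ∷ p} {inside ∷ q} p⊆∁q =
  trans (cong suc (∣p∪q∣≡∣p∣+∣q∣ (drop-∷-⊆ p⊆∁q))) (sym (+-suc _ _))
∣p∪q∣≡∣p∣+∣q∣ {p = outside ∷ p} {outside ∷ q} p⊆∁q = ∣p∪q∣≡∣p∣+∣q∣ (drop-∷-⊆ p⊆∁q)

∣p∣+∣∁p∣≡n : ∀ {n} (p : Subset n) → ∣ p ∣ + ∣ ∁ p ∣ ≡ n
∣p∣+∣∁p∣≡n p = trans (cong (∣ p ∣ +_) (∣∁p∣≡n∸∣p∣ p)) (m+[n∸m]≡n (∣p∣≤n p))

sizeAtMostIn? : ∀ {n} (C : Subset n) k → Decidable (λ I → I ⊆ C × ∣ I ∣ ≤ k)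
sizeAtMostIn? C k I = (I ⊆? C) ×-dec (∣ I ∣ ≤? k)

subsetsOfSizeAtMost : ∀ {n} → Subset n → ℕ → List (Subset n)
subsetsOfSizeAtMost {n} C k = filter (sizeAtMostIn? C k) (allSubsets n)

∈-subsetsOfSizeAtMost⇔ : ∀ {n} {C I : Subset n} {k} →
                          I ∈ subsetsOfSizeAtMost C k ⇔ (I ⊆ C × ∣ I ∣ ≤ k)
∈-subsetsOfSizeAtMost⇔ {n} {C} {I} {k} =
  mk⇔ (proj₂ ∘ ∈-filter⁻ (sizeAtMostIn? C k) {xs = allSubsets n})
      (∈-filter⁺ (sizeAtMostIn? C k) (∈-allSubsets I))

filter-×-≐ : ∀ {A : Set} {P Q R : A → Set}
             (P? : Decidable P) (Q? : Decidable Q) (R? : Decidable R) →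
             (∀ {x} → P x → Q x ⇔ R x) → ∀ xs →
             filter (λ x → P? x ×-dec Q? x) xs ≡ filter (λ x → P? x ×-dec R? x) xs
filter-×-≐ P? Q? R? Q⇔R = filter-≐ _ _
  ( (λ (p , q) → p , Equivalence.to (Q⇔R p) q)
  , (λ (p , r) → p , Equivalence.from (Q⇔R p) r))

subsetsOfSizeAtMost-⊓ : ∀ {n} (C : Subset n) k →
                        subsetsOfSizeAtMost C k ≡ subsetsOfSizeAtMost C (k ⊓ ∣ C ∣)
subsetsOfSizeAtMost-⊓ {n} C k = filter-×-≐ (_⊆? C) (λ I → ∣ I ∣ ≤? k) (λ I → ∣ I ∣ ≤? k ⊓ ∣ C ∣)
  (λ I⊆C → mk⇔ (λ ∣I∣≤k → ⊓-glb ∣I∣≤k (p⊆q⇒∣p∣≤∣q∣ I⊆C))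
                (λ ∣I∣≤k⊓∣C∣ → ≤-trans ∣I∣≤k⊓∣C∣ (m⊓n≤m k _)))
  (allSubsets n)

subsetsOfSizeAtMost-reflects-≤ : ∀ {n} (C : Subset n) {j k} → j ≤ ∣ C ∣ →
                                 subsetsOfSizeAtMost C j ≡ subsetsOfSizeAtMost C k → j ≤ k
subsetsOfSizeAtMost-reflects-≤ C j≤∣C∣ eq with I , I⊆C , ∣I∣≡j ← ⊆-ofSize C j≤∣C∣ =
  subst (_≤ _) ∣I∣≡j (proj₂ (Equivalence.to ∈-subsetsOfSizeAtMost⇔
    (subst (I ∈_) eq (Equivalence.from ∈-subsetsOfSizeAtMost⇔ (I⊆C , ≤-reflexive ∣I∣≡j)))))

subsetsOfSizeAtMost-injective : ∀ {n} (C : Subset n) {j k} → j ≤ ∣ C ∣ → k ≤ ∣ C ∣ →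
                                subsetsOfSizeAtMost C j ≡ subsetsOfSizeAtMost C k → j ≡ k
subsetsOfSizeAtMost-injective C j≤∣C∣ k≤∣C∣ eq =
  ≤-antisym (subsetsOfSizeAtMost-reflects-≤ C j≤∣C∣ eq) (subsetsOfSizeAtMost-reflects-≤ C k≤∣C∣ (sym eq))

maxList-lub : ∀ {m} {xs : List ℕ} → All (_≤ m) xs → maxList xs ≤ m
maxList-lub All.[] = z≤n
maxList-lub (x≤m All.∷ xs≤m) = ⊔-lub x≤m (maxList-lub xs≤m)

∈⇒≤maxList : ∀ {x xs} → x ∈ xs → x ≤ maxList xs
∈⇒≤maxList {xs = y ∷ xs} (here refl) = m≤m⊔n y (maxList xs)
∈⇒≤maxList {xs = y ∷ xs} (there x∈xs) = ≤-trans (∈⇒≤maxList x∈xs) (m≤n⊔m y (maxList xs))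

m∸n≤suc[m∸suc[n]] : ∀ m n → m ∸ n ≤ suc (m ∸ suc n)
m∸n≤suc[m∸suc[n]] zero zero = z≤n
m∸n≤suc[m∸suc[n]] zero (suc n) = z≤n
m∸n≤suc[m∸suc[n]] (suc m) zero = ≤-refl
m∸n≤suc[m∸suc[n]] (suc m) (suc n) = m∸n≤suc[m∸suc[n]] m n

[m+n]⊓o≡m+n⊓o⇔m≤o∸n : ∀ m n o → (m + n) ⊓ o ≡ m + n ⊓ o ⇔ m ≤ o ∸ n
[m+n]⊓o≡m+n⊓o⇔m≤o∸n m n o with ≤-total n o
... | inj₁ n≤o rewrite m≤n⇒m⊓n≡m n≤o =
  mk⇔ (m+n≤o⇒m≤o∸n m ∘ m⊓n≡m⇒m≤n) (m≤n⇒m⊓n≡m ∘ m≤o∸n⇒m+n≤o m n≤o)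
... | inj₂ o≤n rewrite m≥n⇒m⊓n≡n o≤n | m≥n⇒m⊓n≡n (≤-trans o≤n (m≤n+m n m)) | m≤n⇒m∸n≡0 o≤n =
  mk⇔ (λ o≡m+o → ≤-reflexive (+-cancelʳ-≡ o m 0 (sym o≡m+o))) (λ { z≤n → refl })

suc[n⊓o∸[n∸m]⊓o]≡m⊓n+o⊓n∸n+1 : ∀ m n o → n ≤ m + o →
                               suc (n ⊓ o ∸ (n ∸ m) ⊓ o) ≡ m ⊓ n + o ⊓ n ∸ n + 1
suc[n⊓o∸[n∸m]⊓o]≡m⊓n+o⊓n∸n+1 m n o n≤m+o = begin
  suc (n ⊓ o ∸ (n ∸ m) ⊓ o)               ≡⟨ cong (λ x → suc (n ⊓ o ∸ x)) (m≤n⇒m⊓n≡m (m≤n+o⇒m∸n≤o n m n≤m+o)) ⟩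
  suc (n ⊓ o ∸ (n ∸ m))                   ≡⟨ cong (λ x → suc (x ∸ (n ∸ m))) (⊓-comm n o) ⟩
  suc (o ⊓ n ∸ (n ∸ m))                   ≡⟨ +-comm 1 _ ⟩
  o ⊓ n ∸ (n ∸ m) + 1                     ≡⟨ cong (λ x → o ⊓ n ∸ x + 1) (sym n∸m⊓n≡n∸m) ⟩
  o ⊓ n ∸ (n ∸ m ⊓ n) + 1                 ≡⟨ cong (_+ 1) ([m+n]∸[m+o]≡n∸o (m ⊓ n) (o ⊓ n) (n ∸ m ⊓ n)) ⟨
  m ⊓ n + o ⊓ n ∸ (m ⊓ n + (n ∸ m ⊓ n)) + 1 ≡⟨ cong (λ x → m ⊓ n + o ⊓ n ∸ x + 1) (m+[n∸m]≡n (m⊓n≤n m n)) ⟩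
  m ⊓ n + o ⊓ n ∸ n + 1                   ∎
  where
  open ≡-Reasoning
  n∸m⊓n≡n∸m : n ∸ m ⊓ n ≡ n ∸ m
  n∸m⊓n≡n∸m = trans (∸-distribˡ-⊓-⊔ n m n) (trans (cong (n ∸ m ℕ.⊔_) (n∸n≡0 n)) (⊔-identityʳ (n ∸ m)))

intermediate-value : (f : ℕ → ℕ) → (∀ y → f y ≤ suc (f (suc y))) →
                     ∀ {i k} → f i ≤ k → k ≤ f 0 → ∃[ y ] (y ≤ i × f y ≡ k)
intermediate-value f step {zero} f0≤k k≤f0 = 0 , z≤n , ≤-antisym f0≤k k≤f0
intermediate-value f step {suc i} {k} f[1+i]≤k k≤f0 with f i ≤? k
... | yes fi≤k with y , y≤i , fy≡k ← intermediate-value f step fi≤k k≤f0 = y , m≤n⇒m≤1+n y≤i , fy≡k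
... | no fi≰k = suc i , ≤-refl , ≤-antisym f[1+i]≤k (s≤s⁻¹ (≤-trans (≰⇒> fi≰k) (step i)))

applyFromTo : ∀ {A : Set} → (ℕ → A) → ℕ → ℕ → List A
applyFromTo f lo hi = applyUpTo (λ d → f (d + lo)) (suc (hi ∸ lo))

module _ {A : Set} (f : ℕ → A) {lo hi : ℕ} (lo≤hi : lo ≤ hi) where

  private
    offset-bounded : ∀ {d} → d < suc (hi ∸ lo) → d + lo ≤ hi
    offset-bounded d< = m≤o∸n⇒m+n≤o _ lo≤hi (s≤s⁻¹ d<)

  ∈-applyFromTo⇔ : ∀ {x} → x ∈ applyFromTo f lo hi ⇔ (∃[ k ] (lo ≤ k × k ≤ hi × x ≡ f k))
  ∈-applyFromTo⇔ = mk⇔ to from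
    where
    to : ∀ {x} → x ∈ applyFromTo f lo hi → ∃[ k ] (lo ≤ k × k ≤ hi × x ≡ f k)
    to x∈ with d , d< , x≡ ← ∈-applyUpTo⁻ (λ d → f (d + lo)) x∈ =
      d + lo , m≤n+m lo d , offset-bounded d< , x≡
    from : ∀ {x} → ∃[ k ] (lo ≤ k × k ≤ hi × x ≡ f k) → x ∈ applyFromTo f lo hi
    from (k , lo≤k , k≤hi , refl) = subst (λ j → f j ∈ applyFromTo f lo hi) (m∸n+n≡m lo≤k)
      (∈-applyUpTo⁺ (λ d → f (d + lo)) (s≤s (∸-monoˡ-≤ lo k≤hi)))

  applyFromTo-unique : (∀ {j k} → j ≤ hi → k ≤ hi → f j ≡ f k → j ≡ k) → Unique (applyFromTo f lo hi)
  applyFromTo-unique f-injective = applyUpTo⁺₁ _ _ λ {a} {b} a<b b< f[a+lo]≡f[b+lo] →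
    <⇒≢ a<b (+-cancelʳ-≡ lo a b
      (f-injective (offset-bounded (<-trans a<b b<)) (offset-bounded b<) f[a+lo]≡f[b+lo]))

module _ {A : Set} (_≟_ : DecidableEquality A) where

  length-deduplicate-∼set : ∀ {xs ys : List A} → Unique ys → (∀ {x} → x ∈ xs ⇔ x ∈ ys) →
                            length (deduplicate _≟_ xs) ≡ length ys
  length-deduplicate-∼set {xs} ys-unique xs⇔ys = ↭-length (∼bag⇒↭ (unique∧set⇒bag
    (deduplicate-! _≟_ xs) ys-unique (xs⇔ys ⇔-∘ ⇔-sym (deduplicate-∈⇔ _≟_))))

  length-deduplicate-interval : (f : ℕ → A) {lo hi : ℕ} → lo ≤ hi →
                                (∀ {j k} → j ≤ hi → k ≤ hi → f j ≡ f k → j ≡ k) →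
                                ∀ {xs} → (∀ {x} → x ∈ xs ⇔ (∃[ k ] (lo ≤ k × k ≤ hi × x ≡ f k))) →
                                length (deduplicate _≟_ xs) ≡ suc (hi ∸ lo)
  length-deduplicate-interval f {lo} {hi} lo≤hi f-injective xs⇔ =
    trans (length-deduplicate-∼set (applyFromTo-unique f lo≤hi f-injective)
                                   (⇔-sym (∈-applyFromTo⇔ f lo≤hi) ⇔-∘ xs⇔))
          (length-applyUpTo (λ d → f (d + lo)) (suc (hi ∸ lo)))

module Uniform {n : ℕ} (M : Matroid n) (uniform : IsUniform M) where

  r : ℕ
  r = rank M

  rk-uniform : ∀ X → rk M X ≡ ∣ X ∣ ⊓ r
  rk-uniform X = ≤-antisym (maxList-lub (All.tabulate bounded)) attained
    where
    independentIn? : Decidable (λ Y → Y ⊆ X × indep M Y ≡ true)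
    independentIn? Y = (Y ⊆? X) ×-dec (indep M Y BoolP.≟ true)
    bounded : ∀ {s} → s ∈ map ∣_∣ (filter independentIn? (allSubsets n)) → s ≤ ∣ X ∣ ⊓ r
    bounded s∈ with Y , Y∈ , refl ← ∈-map⁻ ∣_∣ s∈
               with _ , Y⊆X , Y-indep ← ∈-filter⁻ independentIn? {xs = allSubsets n} Y∈ =
      ⊓-glb (p⊆q⇒∣p∣≤∣q∣ Y⊆X) (proj₁ (uniform Y) Y-indep)
    attained : ∣ X ∣ ⊓ r ≤ rk M X
    attained with Y , Y⊆X , ∣Y∣≡ ← ⊆-ofSize X (m⊓n≤m (∣ X ∣) r) = subst (_≤ rk M X) ∣Y∣≡
      (∈⇒≤maxList (∈-map⁺ ∣_∣ (∈-filter⁺ independentIn? (∈-allSubsets Y)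
        (Y⊆X , proj₂ (uniform Y) (subst (_≤ r) (sym ∣Y∣≡) (m⊓n≤n (∣ X ∣) r))))))

  rank≤n : r ≤ n
  rank≤n = subst (_≤ n) (sym (rk-uniform ⊤)) (m≤n⇒m⊓o≤n r (≤-reflexive (∣⊤∣≡n n)))

  conn-uniform : ∀ X → conn M X ≡ ∣ X ∣ ⊓ r + ∣ ∁ X ∣ ⊓ r ∸ r
  conn-uniform X = cong₂ (λ a b → a + b ∸ r) (rk-uniform X) (rk-uniform (∁ X))

  module OnInitialSegment (i : ℕ) where

    E C : Subset n
    E = initSeg n i
    C = ∁ E

    level : ℕ → ℕ
    level y = (r ∸ y) ⊓ ∣ C ∣

    level-antitone : ∀ {y z} → y ≤ z → level z ≤ level y
    level-antitone y≤z = ⊓-monoˡ-≤ ∣ C ∣ (∸-monoʳ-≤ r y≤z)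

    level-step : ∀ y → level y ≤ suc (level (suc y))
    level-step y = ⊓-mono-≤ (m∸n≤suc[m∸suc[n]] r y) (n≤1+n ∣ C ∣)

    minorIndeps-level : ∀ {Y} → Y ⊆ E → minorIndeps M i Y ≡ subsetsOfSizeAtMost C (level ∣ Y ∣)
    minorIndeps-level {Y} Y⊆E = trans
      (filter-×-≐ (_⊆? C) (λ I → rk M (I ∪ Y) ℕ.≟ ∣ I ∣ + rk M Y) (λ I → ∣ I ∣ ≤? r ∸ ∣ Y ∣)
                  independent-over-Y (allSubsets n))
      (subsetsOfSizeAtMost-⊓ C (r ∸ ∣ Y ∣))
      where
      independent-over-Y : ∀ {I} → I ⊆ C → (rk M (I ∪ Y) ≡ ∣ I ∣ + rk M Y) ⇔ (∣ I ∣ ≤ r ∸ ∣ Y ∣)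
      independent-over-Y {I} I⊆C
        rewrite rk-uniform (I ∪ Y) | rk-uniform Y
              | ∣p∪q∣≡∣p∣+∣q∣ (λ x∈I → x∉p⇒x∈∁p (x∈∁p⇒x∉p (I⊆C x∈I) ∘ Y⊆E))
        = [m+n]⊓o≡m+n⊓o⇔m≤o∸n (∣ I ∣) (∣ Y ∣) r

    ∈-minorsOn⇔ : ∀ {x} → x ∈ minorsOn M i ⇔
                  (∃[ k ] (level ∣ E ∣ ≤ k × k ≤ level 0 × x ≡ subsetsOfSizeAtMost C k))
    ∈-minorsOn⇔ = mk⇔ to from
      where
      to : ∀ {x} → x ∈ minorsOn M i → ∃[ k ] (level ∣ E ∣ ≤ k × k ≤ level 0 × x ≡ subsetsOfSizeAtMost C k)
      to x∈ with Y , Y∈ , refl ← ∈-map⁻ (minorIndeps M i) x∈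
            with _ , Y⊆E ← ∈-filter⁻ (_⊆? E) {xs = allSubsets n} Y∈ =
        level ∣ Y ∣ , level-antitone (p⊆q⇒∣p∣≤∣q∣ Y⊆E) , level-antitone {z = ∣ Y ∣} z≤n ,
        minorIndeps-level Y⊆E
      from : ∀ {x} → ∃[ k ] (level ∣ E ∣ ≤ k × k ≤ level 0 × x ≡ subsetsOfSizeAtMost C k) → x ∈ minorsOn M i
      from (k , lo≤k , k≤hi , refl)
        with y , y≤∣E∣ , level-y≡k ← intermediate-value level level-step lo≤k k≤hi
        with Y , Y⊆E , refl ← ⊆-ofSize E y≤∣E∣ =
        subst (_∈ minorsOn M i) (trans (minorIndeps-level Y⊆E) (cong (subsetsOfSizeAtMost C) level-y≡k))
          (∈-map⁺ (minorIndeps M i) (∈-filter⁺ (_⊆? E) (∈-allSubsets Y) Y⊆E))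

    numMinors-levels : numMinors M i ≡ suc (level 0 ∸ level ∣ E ∣)
    numMinors-levels = length-deduplicate-interval (ListP.≡-dec (VecP.≡-dec BoolP._≟_))
      (subsetsOfSizeAtMost C) (level-antitone {z = ∣ E ∣} z≤n)
      (λ j≤ k≤ → subsetsOfSizeAtMost-injective C (≤-trans j≤ (m⊓n≤n r ∣ C ∣))
                                                   (≤-trans k≤ (m⊓n≤n r ∣ C ∣)))
      ∈-minorsOn⇔

theorem4p1 : (n : ℕ) (M : Matroid n) → IsUniform M → (i : ℕ) → i ≤ n →
             numMinors M i ≡ conn M (initSeg n i) + 1
theorem4p1 n M uniform i _ = begin
  numMinors M i                        ≡⟨ numMinors-levels ⟩
  suc (r ⊓ ∣ C ∣ ∸ (r ∸ ∣ E ∣) ⊓ ∣ C ∣) ≡⟨ suc[n⊓o∸[n∸m]⊓o]≡m⊓n+o⊓n∸n+1 (∣ E ∣) r (∣ C ∣) r≤∣E∣+∣C∣ ⟩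
  ∣ E ∣ ⊓ r + ∣ C ∣ ⊓ r ∸ r + 1        ≡⟨ cong (_+ 1) (conn-uniform E) ⟨
  conn M E + 1                         ∎
  where
  open Uniform M uniform
  open OnInitialSegment i
  open ≡-Reasoning
  r≤∣E∣+∣C∣ : r ≤ ∣ E ∣ + ∣ C ∣
  r≤∣E∣+∣C∣ = subst (r ≤_) (sym (∣p∣+∣∁p∣≡n E)) rank≤n
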